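{- Let $z \ge 6$ be an integer. Then (1) $\ell(z) > 4z$; and (2) for every integer $n \ge \ell(z)$, $n^2 - zn + b(z) \ge (3/4)n^2$.
   Context: A reachable pair of a digraph is an ordered pair $(\alpha,\beta)$ of (not necessarily distinct) vertices with a directed path (possibly of length $0$) from $\alpha$ to $\beta$; the weight of a digraph is its number of reachable pairs. $W(n)$ is the set of weights of digraphs on $n$ vertices, $b(n)$ is the largest integer such that every integer $k$ with $n\le k\le b(n)$ lies in $W(n)$, and $\ell(z) := b(z)-z+3$. -}

module Defs where

open import Data.Nat using (ℕ; zero; suc; _+_; _≤_)
open import Data.Bool using (Bool; true; false; if_then_else_)
open import Data.Fin using (Fin)
open import Data.List using (List; map)
open import Data.Nat.ListAction using (sum)
open import Data.List.Base using (allFin)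
open import Data.Product using (Σ; _×_)
open import Function.Bundles using (_⇔_)
open import Relation.Nullary using (¬_)
open import Relation.Binary.PropositionalEquality using (_≡_)
open import Relation.Binary.Construct.Closure.ReflexiveTransitive using (Star)

Digraph : ℕ → Set
Digraph n = Fin n → Fin n → Bool

Arc : ∀ {n} → Digraph n → Fin n → Fin n → Set
Arc G a b = G a b ≡ true

Reachable : ∀ {n} → Digraph n → Fin n → Fin n → Set
Reachable G = Star (Arc G)

countPairs : ∀ {n} → (Fin n → Fin n → Bool) → ℕ
countPairs {n} S =
  sum (map (λ a → sum (map (λ b → if S a b then 1 else 0) (allFin n))) (allFin n))

HasWeight : ∀ {n} → Digraph n → ℕ → Set
HasWeight {n} G k =
  Σ (Fin n → Fin n → Bool) λ S →
    (∀ a b → (S a b ≡ true) ⇔ Reachable G a b) × (countPairs S ≡ k)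

InW : ℕ → ℕ → Set
InW n k = Σ (Digraph n) λ G → HasWeight G k

-- b is b(n): every k with n ≤ k ≤ b lies in W(n), and b is the largest such
-- integer (i.e. b + 1 ∉ W(n)).
IsB : ℕ → ℕ → Set
IsB n b = (∀ k → n ≤ k → k ≤ b → InW n k) × ¬ InW n (suc b)

-- W(z) is decidable: reachability in a finite digraph is computable and there
-- are finitely many digraphs; and z² + 1 ∉ W(z). So b(z) exists and can be found
-- by scanning upwards. Every k ∈ [z, 5z − 2] is a weight: for z = 6 by explicit
-- digraphs, and from z to z + 1 by adding an isolated vertex (weight + 1) or a
-- vertex with arcs to all others (weight + z + 1). Hence ℓ(z) ≥ 4z + 1, and
-- zn ≤ n²/4 once n ≥ ℓ(z).
module Submission where

open import Defs
open import Data.Nat using (ℕ; zero; suc; _+_; _*_; _∸_; _≤_; _<_; z≤n; s≤s; s≤s⁻¹; _≡ᵇ_)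
open import Data.Nat.Properties
open import Algebra.Properties.Monoid.Sum +-0-monoid using (sum-cong-≗) renaming (sum to ∑)
open import Data.Bool using (Bool; true; false; if_then_else_; _∧_)
open import Data.Bool.Properties using (⇔→≡) renaming (_≟_ to _≟ᴮ_)
open import Data.Fin using (Fin; zero; suc; toℕ; fromℕ<; combine; remQuot)
open import Data.Fin.Properties using (any?; all?; remQuot-combine; toℕ-fromℕ<)
open import Data.Fin.Subset using (Subset; _∈_; _∉_; _∪_; ⁅_⁆; ∣_∣)
open import Data.Fin.Subset.Properties
  using (_∈?_; ∣p∣≤n; p⊂q⇒∣p∣<∣q∣; p⊆p∪q; x∈p∪q⁺; x∈p∪q⁻; x∈⁅x⁆; x∈⁅y⁆⇒x≡y; anySubset?)
open import Data.Vec using (Vec; lookup; tabulate; _∷_; [])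
open import Data.Vec.Properties using (lookup∘tabulate; []=⇒lookup; lookup⇒[]=)
open import Data.List using (List; []; _∷_; map; allFin)
open import Data.Bool.ListAction using (any)
open import Data.List.Properties using (map-tabulate)
open import Data.Nat.ListAction using (sum)
open import Data.Product using (Σ; ∃; ∃₂; _×_; _,_; proj₁; proj₂; uncurry)
open import Data.Sum using (_⊎_; inj₁; inj₂)
open import Data.Empty using (⊥-elim)
open import Function using (_∘_; id; case_of_)
open import Function.Bundles using (_⇔_; mk⇔; module Equivalence)
open import Function.Properties.Equivalence using () renaming (trans to ⇔-trans; sym to ⇔-sym)
open import Relation.Nullary using (¬_; Dec; yes; no; contradiction)
open import Relation.Nullary.Decidable using (_×-dec_; ¬?; map′; from-yes)
open import Relation.Unary using (Decidable)
open import Relation.Binary.PropositionalEquality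
open import Relation.Binary.Construct.Closure.ReflexiveTransitive using (ε; _◅_; _◅◅_; gmap)

bit : Bool → ℕ
bit b = if b then 1 else 0

bit≤1 : ∀ b → bit b ≤ 1
bit≤1 true  = ≤-refl
bit≤1 false = z≤n

∑-≤ : ∀ {n} {f : Fin n → ℕ} c → (∀ i → f i ≤ c) → ∑ f ≤ n * c
∑-≤ {zero}  c f≤c = z≤n
∑-≤ {suc n} c f≤c = +-mono-≤ (f≤c zero) (∑-≤ c (f≤c ∘ suc))

∑-const : ∀ n k → ∑ {n} (λ _ → k) ≡ n * k
∑-const zero    k = refl
∑-const (suc n) k = cong (k +_) (∑-const n k)

sum-map-allFin : ∀ {n} (f : Fin n → ℕ) → sum (map f (allFin n)) ≡ ∑ f
sum-map-allFin {zero}  f = refl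
sum-map-allFin {suc n} f = cong (f zero +_) (begin
  sum (map f (Data.List.tabulate suc))  ≡⟨ cong sum (map-tabulate suc f) ⟩
  sum (Data.List.tabulate (f ∘ suc))    ≡⟨ cong sum (map-tabulate id (f ∘ suc)) ⟨
  sum (map (f ∘ suc) (allFin n))        ≡⟨ sum-map-allFin (f ∘ suc) ⟩
  ∑ (f ∘ suc)                           ∎)
  where open ≡-Reasoning

module _ {n : ℕ} where

  countPairs-∑ : (S : Fin n → Fin n → Bool) → countPairs S ≡ ∑ λ a → ∑ λ b → bit (S a b)
  countPairs-∑ S = trans (sum-map-allFin {n} _) (sum-cong-≗ {n} λ a → sum-map-allFin {n} λ b → bit (S a b))

  countPairs-cong : {S T : Fin n → Fin n → Bool} → (∀ a b → S a b ≡ T a b) → countPairs S ≡ countPairs T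
  countPairs-cong {S} {T} S≗T = begin
    countPairs S                      ≡⟨ countPairs-∑ S ⟩
    (∑ λ a → ∑ λ b → bit (S a b))     ≡⟨ sum-cong-≗ (λ a → sum-cong-≗ λ b → cong bit (S≗T a b)) ⟩
    (∑ λ a → ∑ λ b → bit (T a b))     ≡⟨ countPairs-∑ T ⟨
    countPairs T                      ∎
    where open ≡-Reasoning

  countPairs≤n*n : (S : Fin n → Fin n → Bool) → countPairs S ≤ n * n
  countPairs≤n*n S = subst (_≤ n * n) (sym (countPairs-∑ S))
    (∑-≤ n λ a → subst (∑ (λ b → bit (S a b)) ≤_) (*-identityʳ n) (∑-≤ 1 λ b → bit≤1 (S a b)))

module _ {n : ℕ} (G : Digraph n) where

  ArcClosed : Subset n → Set
  ArcClosed p = ∀ {b c} → b ∈ p → Arc G b c → c ∈ p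

  LeavingArc : Subset n → Set
  LeavingArc p = ∃₂ λ b c → b ∈ p × Arc G b c × c ∉ p

  arcClosed⊎leavingArc : ∀ p → ArcClosed p ⊎ LeavingArc p
  arcClosed⊎leavingArc p
    with any? (λ b → any? λ c → b ∈? p ×-dec G b c ≟ᴮ true ×-dec ¬? (c ∈? p))
  ... | yes leaving = inj₂ leaving
  ... | no none     = inj₁ closed
    where
    closed : ArcClosed p
    closed {b} {c} b∈p bc with c ∈? p
    ... | yes c∈p = c∈p
    ... | no  c∉p = contradiction (b , c , b∈p , bc , c∉p) none

  arcClosed⇒reachClosed : ∀ {p} → ArcClosed p → ∀ {a c} → a ∈ p → Reachable G a c → c ∈ p
  arcClosed⇒reachClosed closed a∈p ε           = a∈p
  arcClosed⇒reachClosed closed a∈p (bc ◅ path) = arcClosed⇒reachClosed closed (closed a∈p bc) path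

  ReachableSet : Fin n → Set
  ReachableSet a = Σ (Subset n) λ q → ∀ c → c ∈ q ⇔ Reachable G a c

  -- Grow p by the head of a leaving arc until it is closed; the fuel bound holds
  -- because ∣ p ∣ increases at every step and never exceeds n.
  saturate : ∀ {a} fuel p → n < fuel + ∣ p ∣ → a ∈ p → (∀ {c} → c ∈ p → Reachable G a c) → ReachableSet a
  saturate zero p bound a∈p reach = ⊥-elim (<⇒≱ bound (∣p∣≤n p))
  saturate {a} (suc fuel) p bound a∈p reach with arcClosed⊎leavingArc p
  ... | inj₁ closed = p , λ c → mk⇔ reach (arcClosed⇒reachClosed closed a∈p)
  ... | inj₂ (b , c , b∈p , bc , c∉p) =
    saturate fuel (p ∪ ⁅ c ⁆) bound′ (p⊆p∪q ⁅ c ⁆ a∈p) reach′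
    where
    c∈p′ : c ∈ p ∪ ⁅ c ⁆
    c∈p′ = x∈p∪q⁺ (inj₂ (x∈⁅x⁆ c))

    bound′ : n < fuel + ∣ p ∪ ⁅ c ⁆ ∣
    bound′ = begin-strict
      n                      <⟨ bound ⟩
      suc fuel + ∣ p ∣        ≡⟨ +-suc fuel ∣ p ∣ ⟨
      fuel + suc ∣ p ∣        ≤⟨ +-monoʳ-≤ fuel (p⊂q⇒∣p∣<∣q∣ (p⊆p∪q ⁅ c ⁆ , c , c∈p′ , c∉p)) ⟩
      fuel + ∣ p ∪ ⁅ c ⁆ ∣    ∎
      where open ≤-Reasoning

    reach′ : ∀ {d} → d ∈ p ∪ ⁅ c ⁆ → Reachable G a d
    reach′ d∈ with x∈p∪q⁻ p ⁅ c ⁆ d∈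
    ... | inj₁ d∈p = reach d∈p
    ... | inj₂ d∈c rewrite x∈⁅y⁆⇒x≡y c d∈c = reach b∈p ◅◅ (bc ◅ ε)

  reachableSet : ∀ a → ReachableSet a
  reachableSet a = saturate (suc n) ⁅ a ⁆ (s≤s (m≤m+n n _)) (x∈⁅x⁆ a)
    λ c∈ → subst (Reachable G a) (sym (x∈⁅y⁆⇒x≡y a c∈)) ε

  reachability : Fin n → Fin n → Bool
  reachability a = lookup (proj₁ (reachableSet a))

  reachability-correct : ∀ a b → (reachability a b ≡ true) ⇔ Reachable G a b
  reachability-correct a b =
    ⇔-trans (mk⇔ (lookup⇒[]= b _) []=⇒lookup) (proj₂ (reachableSet a) b)

  weight : ℕ
  weight = countPairs reachability

  hasWeight : HasWeight G weight
  hasWeight = reachability , reachability-correct , refl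

  hasWeight⇒weight≡ : ∀ {k} → HasWeight G k → weight ≡ k
  hasWeight⇒weight≡ (S , S-correct , count) = trans
    (countPairs-cong λ a b → ⇔→≡ (⇔-trans (reachability-correct a b) (⇔-sym (S-correct a b))))
    count

  hasWeight? : ∀ k → Dec (HasWeight G k)
  hasWeight? k = map′ (λ w≡k → subst (HasWeight G) w≡k hasWeight) hasWeight⇒weight≡ (weight ≟ k)

Reachable-≗ : ∀ {n} {G H : Digraph n} → (∀ a b → G a b ≡ H a b) → ∀ {a b} → Reachable G a b → Reachable H a b
Reachable-≗ G≗H = gmap id λ {a} {b} arc → trans (sym (G≗H a b)) arc

hasWeight-≗ : ∀ {n k} {G H : Digraph n} → (∀ a b → G a b ≡ H a b) → HasWeight G k → HasWeight H k
hasWeight-≗ G≗H (S , S-correct , count) =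
  S , (λ a b → ⇔-trans (S-correct a b) (mk⇔ (Reachable-≗ G≗H) (Reachable-≗ λ x y → sym (G≗H x y)))) , count

-- Coding digraphs as subsets of Fin (n * n) turns InW into a search over subsets.
fromCode : ∀ {n} → Subset (n * n) → Digraph n
fromCode s a b = lookup s (combine a b)

toCode : ∀ {n} → Digraph n → Subset (n * n)
toCode {n} G = tabulate (uncurry G ∘ remQuot n)

fromCode-toCode : ∀ {n} (G : Digraph n) a b → fromCode (toCode G) a b ≡ G a b
fromCode-toCode {n} G a b = trans (lookup∘tabulate (uncurry G ∘ remQuot n) (combine a b)) (cong (uncurry G) (remQuot-combine a b))

InW? : ∀ n k → Dec (InW n k)
InW? n k = map′
  (λ (s , h) → fromCode s , h)
  (λ (G , h) → toCode G , hasWeight-≗ (λ a b → sym (fromCode-toCode G a b)) h)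
  (anySubset? λ s → hasWeight? (fromCode s) k)

InW-≤ : ∀ {n k} → InW n k → k ≤ n * n
InW-≤ (G , S , _ , count) = subst (_≤ _) count (countPairs≤n*n S)

addVertex : ∀ {n} → Bool → Digraph n → Digraph (suc n)
addVertex c G zero    zero    = false
addVertex c G zero    (suc j) = c
addVertex c G (suc i) zero    = false
addVertex c G (suc i) (suc j) = G i j

addVertexReach : ∀ {n} → Bool → (Fin n → Fin n → Bool) → Fin (suc n) → Fin (suc n) → Bool
addVertexReach c S zero    zero    = true
addVertexReach c S zero    (suc j) = c
addVertexReach c S (suc i) zero    = false
addVertexReach c S (suc i) (suc j) = S i j

Reachable-addVertex-suc⁻ : ∀ {n c} {G : Digraph n} {a y} → Reachable (addVertex c G) (suc a) y →
  ∃ λ b → y ≡ suc b × Reachable G a b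
Reachable-addVertex-suc⁻ ε = _ , refl , ε
Reachable-addVertex-suc⁻ (_◅_ {j = zero}  () path)
Reachable-addVertex-suc⁻ (_◅_ {j = suc _} arc path) with Reachable-addVertex-suc⁻ path
... | b , refl , path′ = b , refl , arc ◅ path′

addVertexReach-correct : ∀ {n} c (G : Digraph n) (S : Fin n → Fin n → Bool) →
  (∀ a b → (S a b ≡ true) ⇔ Reachable G a b) →
  ∀ x y → (addVertexReach c S x y ≡ true) ⇔ Reachable (addVertex c G) x y
addVertexReach-correct c     G S S-correct zero    zero    = mk⇔ (λ _ → ε) (λ _ → refl)
addVertexReach-correct true  G S S-correct zero    (suc b) = mk⇔ (λ _ → refl ◅ ε) (λ _ → refl)
addVertexReach-correct false G S S-correct zero    (suc b) =
  mk⇔ (λ ()) λ { (_◅_ {j = zero} () _) ; (_◅_ {j = suc _} () _) }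
addVertexReach-correct c     G S S-correct (suc a) zero    = mk⇔ (λ ()) λ path →
  case Reachable-addVertex-suc⁻ path of λ { (_ , () , _) }
addVertexReach-correct c     G S S-correct (suc a) (suc b) = mk⇔
  (gmap suc id ∘ Equivalence.to (S-correct a b))
  λ path → case Reachable-addVertex-suc⁻ path of λ { (_ , refl , path′) → Equivalence.from (S-correct a b) path′ }

countPairs-addVertexReach : ∀ {n} c (S : Fin n → Fin n → Bool) →
  countPairs (addVertexReach c S) ≡ suc (n * bit c + countPairs S)
countPairs-addVertexReach {n} c S = begin
  countPairs (addVertexReach c S)                              ≡⟨ countPairs-∑ (addVertexReach c S) ⟩
  suc (∑ {n} (λ _ → bit c) + (∑ λ a → ∑ λ b → bit (S a b)))     ≡⟨ cong suc (cong₂ _+_ (∑-const n (bit c)) (sym (countPairs-∑ S))) ⟩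
  suc (n * bit c + countPairs S)                               ∎
  where open ≡-Reasoning

InW-addVertex : ∀ {n w} c → InW n w → InW (suc n) (suc (n * bit c + w))
InW-addVertex {n} c (G , S , S-correct , count) =
  addVertex c G , addVertexReach c S , addVertexReach-correct c G S S-correct ,
  trans (countPairs-addVertexReach c S) (cong (λ v → suc (n * bit c + v)) count)

InW-isolated : ∀ {n w} → InW n w → InW (suc n) (suc w)
InW-isolated {n} {w} h = subst (λ v → InW (suc n) (suc (v + w))) (*-zeroʳ n) (InW-addVertex false h)

InW-source : ∀ {n w} → InW n w → InW (suc n) (suc n + w)
InW-source {n} {w} h = subst (λ v → InW (suc n) (suc (v + w))) (*-identityʳ n) (InW-addVertex true h)

fromArcs : ∀ {n} → List (ℕ × ℕ) → Digraph n
fromArcs arcs a b = any (λ (i , j) → (toℕ a ≡ᵇ i) ∧ (toℕ b ≡ᵇ j)) arcs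

sixVertexArcs : Vec (List (ℕ × ℕ)) 23
sixVertexArcs =
  [] ∷
  ((2 , 4) ∷ []) ∷
  ((3 , 4) ∷ (5 , 2) ∷ []) ∷
  ((1 , 4) ∷ (5 , 1) ∷ []) ∷
  ((1 , 3) ∷ (2 , 1) ∷ (0 , 3) ∷ []) ∷
  ((5 , 4) ∷ (2 , 5) ∷ (3 , 5) ∷ []) ∷
  ((2 , 4) ∷ (0 , 2) ∷ (3 , 0) ∷ []) ∷
  ((3 , 0) ∷ (0 , 1) ∷ (5 , 0) ∷ (4 , 0) ∷ []) ∷
  ((2 , 1) ∷ (3 , 5) ∷ (4 , 3) ∷ (1 , 3) ∷ []) ∷
  ((5 , 3) ∷ (4 , 3) ∷ (3 , 1) ∷ (1 , 2) ∷ []) ∷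
  ((2 , 1) ∷ (5 , 3) ∷ (1 , 5) ∷ (3 , 4) ∷ []) ∷
  ((2 , 0) ∷ (0 , 4) ∷ (1 , 5) ∷ (1 , 3) ∷ (5 , 2) ∷ []) ∷
  ((4 , 0) ∷ (5 , 1) ∷ (0 , 5) ∷ (1 , 4) ∷ []) ∷
  ((3 , 0) ∷ (4 , 3) ∷ (0 , 1) ∷ (0 , 2) ∷ (1 , 5) ∷ []) ∷
  ((4 , 2) ∷ (5 , 1) ∷ (1 , 4) ∷ (2 , 3) ∷ (0 , 1) ∷ []) ∷
  ((1 , 4) ∷ (5 , 2) ∷ (0 , 1) ∷ (3 , 0) ∷ (4 , 5) ∷ []) ∷
  ((3 , 1) ∷ (0 , 3) ∷ (5 , 0) ∷ (1 , 5) ∷ (2 , 5) ∷ []) ∷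
  ((3 , 2) ∷ (0 , 1) ∷ (3 , 4) ∷ (3 , 1) ∷ (1 , 5) ∷ (5 , 3) ∷ []) ∷
  ((1 , 0) ∷ (0 , 4) ∷ (2 , 5) ∷ (5 , 4) ∷ (4 , 1) ∷ (1 , 3) ∷ []) ∷
  ((4 , 3) ∷ (3 , 1) ∷ (1 , 4) ∷ (2 , 4) ∷ (3 , 5) ∷ (2 , 0) ∷ (0 , 2) ∷ []) ∷
  ((4 , 0) ∷ (0 , 2) ∷ (1 , 3) ∷ (2 , 1) ∷ (3 , 4) ∷ []) ∷
  ((2 , 5) ∷ (0 , 5) ∷ (5 , 1) ∷ (3 , 0) ∷ (4 , 2) ∷ (1 , 3) ∷ []) ∷
  ((5 , 4) ∷ (3 , 1) ∷ (2 , 0) ∷ (0 , 5) ∷ (1 , 3) ∷ (4 , 1) ∷ (4 , 2) ∷ []) ∷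
  []

weight-sixVertexArcs : ∀ t → weight (fromArcs {6} (lookup sixVertexArcs t)) ≡ 6 + toℕ t
weight-sixVertexArcs = from-yes (all? λ t → weight (fromArcs {6} (lookup sixVertexArcs t)) ≟ 6 + toℕ t)

InW-6 : ∀ t → t + 2 ≤ 24 → InW 6 (6 + t)
InW-6 t t+2≤24 = subst (λ k → InW 6 (6 + k)) (toℕ-fromℕ< t<23)
  (subst (InW 6) (weight-sixVertexArcs (fromℕ< t<23)) (G , hasWeight G))
  where
  t<23 : t < 23
  t<23 = s≤s⁻¹ (subst (_≤ 24) (+-comm t 2) t+2≤24)

  G : Digraph 6
  G = fromArcs (lookup sixVertexArcs (fromℕ< t<23))

InW-step : ∀ {z} → 4 ≤ z → (∀ t → t + 2 ≤ 4 * z → InW z (z + t)) →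
  ∀ t → t + 2 ≤ 4 * suc z → InW (suc z) (suc z + t)
InW-step {z} 4≤z small t t+2≤ with z ≤? t
... | no  z≰t = InW-isolated (small t (begin
  t + 2       ≡⟨ +-comm t 2 ⟩
  suc (suc t) ≤⟨ s≤s (≰⇒> z≰t) ⟩
  suc z       ≡⟨ +-comm 1 z ⟩
  z + 1       ≤⟨ +-monoʳ-≤ z (≤-trans (≤-trans (s≤s z≤n) 4≤z) (m≤m+n z _)) ⟩
  4 * z       ∎))
  where open ≤-Reasoning
... | yes z≤t with m≤n⇒∃[o]m+o≡n z≤t
...   | t′ , refl = InW-source (small t′ (+-cancelˡ-≤ z _ _ (begin
  z + (t′ + 2)  ≡⟨ +-assoc z t′ 2 ⟨
  z + t′ + 2    ≤⟨ t+2≤ ⟩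
  4 * suc z     ≡⟨ *-suc 4 z ⟩
  4 + 4 * z     ≤⟨ +-monoˡ-≤ (4 * z) 4≤z ⟩
  z + 4 * z     ∎)))
  where open ≤-Reasoning

InW-6+d : ∀ d t → t + 2 ≤ 4 * (6 + d) → InW (6 + d) (6 + d + t)
InW-6+d zero    = InW-6
InW-6+d (suc d) = InW-step (m≤m+n 4 (2 + d)) (InW-6+d d)

InW-≤5z : ∀ {z} → 6 ≤ z → ∀ k → z ≤ k → k + 2 ≤ 5 * z → InW z k
InW-≤5z 6≤z k z≤k k+2≤5z with m≤n⇒∃[o]m+o≡n 6≤z | m≤n⇒∃[o]m+o≡n z≤k
... | d , refl | t , refl =
  InW-6+d d t (+-cancelˡ-≤ (6 + d) _ _ (subst (_≤ 5 * (6 + d)) (+-assoc (6 + d) t 2) k+2≤5z))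

module _ {P : ℕ → Set} (P? : Decidable P) (lo : ℕ) where

  AllBetween : ℕ → Set
  AllBetween m = ∀ k → lo ≤ k → k ≤ m → P k

  AllBetween-suc : ∀ {m} → AllBetween m → P (suc m) → AllBetween (suc m)
  AllBetween-suc below Psm k lo≤k k≤sm with m≤n⇒m<n∨m≡n k≤sm
  ... | inj₁ k<sm = below k lo≤k (s≤s⁻¹ k<sm)
  ... | inj₂ refl = Psm

  firstGap : ∀ d m → AllBetween m → ¬ P (suc (d + m)) →
    Σ ℕ λ b → m ≤ b × AllBetween b × ¬ P (suc b)
  firstGap d m below ¬P with P? (suc m)
  firstGap d       m below ¬P | no ¬Psm = m , ≤-refl , below , ¬Psm
  firstGap zero    m below ¬P | yes Psm = contradiction Psm ¬P
  firstGap (suc d) m below ¬P | yes Psm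
    with firstGap d (suc m) (AllBetween-suc below Psm) (¬P ∘ subst (P ∘ suc) (+-suc d m))
  ... | b , sm≤b , belowB , ¬Psb = b , ≤-trans (n≤1+n m) sm≤b , belowB , ¬Psb

∃[b]IsB∧5z≤b+2 : ∀ z → 6 ≤ z → Σ ℕ λ b → 5 * z ≤ b + 2 × IsB z b
∃[b]IsB∧5z≤b+2 z 6≤z =
  let b , m≤b , isB = firstGap (InW? z) z (z * z ∸ m) m below ¬InW-suc
  in b , subst (_≤ b + 2) (m∸n+n≡m 2≤5z) (+-monoˡ-≤ 2 m≤b) , isB
  where
  m : ℕ
  m = 5 * z ∸ 2

  2≤5z : 2 ≤ 5 * z
  2≤5z = ≤-trans (≤-trans (m≤m+n 2 4) 6≤z) (m≤m+n z _)

  m≤z*z : m ≤ z * z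
  m≤z*z = ≤-trans (m∸n≤m (5 * z) 2) (*-monoˡ-≤ z (≤-trans (n≤1+n 5) 6≤z))

  below : ∀ k → z ≤ k → k ≤ m → InW z k
  below k z≤k k≤m = InW-≤5z 6≤z k z≤k (m≤o∸n⇒m+n≤o k 2≤5z k≤m)

  ¬InW-suc : ¬ InW z (suc (z * z ∸ m + m))
  ¬InW-suc w = n≮n (z * z) (subst (λ k → suc k ≤ z * z) (m∸n+n≡m m≤z*z) (InW-≤ w))

4z<[b+3]∸z : ∀ z b → 5 * z ≤ b + 2 → 4 * z < b + 3 ∸ z
4z<[b+3]∸z z b 5z≤b+2 = m+n≤o⇒m≤o∸n (suc (4 * z)) (begin
  suc (4 * z) + z   ≡⟨ cong suc (+-comm (4 * z) z) ⟩
  suc (5 * z)       ≤⟨ s≤s 5z≤b+2 ⟩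
  suc (b + 2)       ≡⟨ +-suc b 2 ⟨
  b + 3             ∎)
  where open ≤-Reasoning

3n²+4zn≤4[n²+b] : ∀ z b n → 4 * z ≤ n → 3 * (n * n) + 4 * (z * n) ≤ 4 * (n * n + b)
3n²+4zn≤4[n²+b] z b n 4z≤n = begin
  3 * (n * n) + 4 * (z * n)   ≡⟨ cong (3 * (n * n) +_) (*-assoc 4 z n) ⟨
  3 * (n * n) + 4 * z * n     ≤⟨ +-monoʳ-≤ (3 * (n * n)) (*-monoˡ-≤ n 4z≤n) ⟩
  3 * (n * n) + n * n         ≡⟨ +-comm (3 * (n * n)) (n * n) ⟩
  4 * (n * n)                 ≤⟨ *-monoʳ-≤ 4 (m≤m+n (n * n) b) ⟩
  4 * (n * n + b)             ∎
  where open ≤-Reasoning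

lemma3p3 : (z : ℕ) → 6 ≤ z →
    Σ ℕ λ b → IsB z b ×
      ((4 * z < b + 3 ∸ z) ×
       ((n : ℕ) → b + 3 ∸ z ≤ n → 3 * (n * n) + 4 * (z * n) ≤ 4 * (n * n + b)))
lemma3p3 z 6≤z =
  let b , 5z≤b+2 , isB = ∃[b]IsB∧5z≤b+2 z 6≤z
      4z<ℓ = 4z<[b+3]∸z z b 5z≤b+2
  in b , isB , 4z<ℓ , λ n ℓ≤n → 3n²+4zn≤4[n²+b] z b n (≤-trans (n≤1+n (4 * z)) (≤-trans 4z<ℓ ℓ≤n))
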